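{- Every $m$-colored directed cycle $C_n$ which is not hetero-chromatic has an $H$-kernel by walks, where $H$ is the digraph with $A(H)=\{(u,u):u\in V(H)\}$.
   Context: $H$ is a digraph whose arcs are exactly one loop at each vertex; the arcs of the digraph are colored with vertices of $H$ (colors). A walk $(v_0,\dots,v_n)$ is an $H$-walk if $(c(v_{i-1},v_i),c(v_i,v_{i+1}))\in A(H)$ for all $1\le i\le n-1$; here this means $H$-walks are exactly monochromatic walks (a single vertex and a single arc count as $H$-walks). A set $N$ of vertices is an $H$-kernel by walks if there is no $H$-walk between any two distinct vertices of $N$ and every vertex outside $N$ has an $H$-walk to some vertex of $N$. A colored directed cycle is hetero-chromatic if no two consecutive arcs have the same color. -}

module Defs where

open import Data.Nat using (ℕ; suc; _≤_)
open import Data.Fin using (Fin; zero; suc; fromℕ<)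
open import Data.Fin.Properties using ()
open import Data.Product using (Σ; ∃; _×_; _,_)
open import Data.Sum using (_⊎_)
open import Relation.Binary.PropositionalEquality using (_≡_)
open import Relation.Nullary using (¬_)
open import Data.Nat.DivMod using (_mod_)

record ColoredDigraph (V : Set) (Col : Set) : Set₁ where
  field
    Arc   : V → V → Set
    color : ∀ {u v} → Arc u v → Col

module _ {V Col : Set} (D : ColoredDigraph V Col) where
  open ColoredDigraph D

  data Walk : V → V → Set where
    [] : ∀ {u} → Walk u u
    _∷_ : ∀ {u v w} → Arc u v → Walk v w → Walk u w

  -- H-walk for H the digraph with exactly one loop at each vertex (color):
  -- consecutive arcs (a, b) must satisfy (c(a), c(b)) ∈ A(H), i.e. c(a) ≡ c(b).
  data IsHWalk : ∀ {u v} → Walk u v → Set where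
    hw-nil  : ∀ {u} → IsHWalk ([] {u})
    hw-one  : ∀ {u v} (a : Arc u v) → IsHWalk (a ∷ [])
    hw-cons : ∀ {u v w x} (a : Arc u v) (b : Arc v w) (p : Walk w x) →
              color a ≡ color b → IsHWalk (b ∷ p) → IsHWalk (a ∷ (b ∷ p))

  HWalkTo : V → V → Set
  HWalkTo u v = Σ (Walk u v) IsHWalk

  IsHKernelByWalks : (V → Set) → Set
  IsHKernelByWalks N =
    (∀ u v → N u → N v → ¬ (u ≡ v) → ¬ HWalkTo u v)
    × (∀ u → ¬ N u → ∃ λ v → N v × HWalkTo u v)

cycSuc : {n : ℕ} → Fin n → Fin n
cycSuc {suc n} i = (suc (Data.Fin.toℕ i)) mod (suc n)

-- The directed cycle C_n on vertices Fin n with arcs i → i+1 (mod n),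
-- colored by c : Fin n → Fin m  (c i = color of the arc leaving i).
CycleArc : {n : ℕ} → Fin n → Fin n → Set
CycleArc u v = cycSuc u ≡ v

coloredCycle : (n m : ℕ) → (Fin n → Fin m) → ColoredDigraph (Fin n) (Fin m)
coloredCycle n m c = record { Arc = CycleArc ; color = λ {u} _ → c u }

HeteroChromatic : {n m : ℕ} → (Fin n → Fin m) → Set
HeteroChromatic c = ∀ i → ¬ (c i ≡ c (cycSuc i))

-- An H-walk in a coloured cycle is a run of consecutive arcs of one colour. If all arcs share a
-- colour, any single vertex is a kernel. Otherwise, as the cycle is not hetero-chromatic, some
-- vertex b is entered and left by arcs of different colours while its leaving arc starts a run
-- of length at least two. No monochromatic walk passes through b, so cutting the cycle at b
-- leaves a path on which reachability only points forward; the kernel of that acyclic relation,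
-- built greedily from the far end, is a kernel of the cycle, since b is absorbed through its
-- successor.
module Submission where

open import Data.Empty using (⊥; ⊥-elim)
open import Data.Fin using (Fin; toℕ)
open import Data.Fin.Properties using (toℕ-fromℕ<; toℕ-injective; toℕ<n; any?)
import Data.Fin.Properties as Fin
open import Data.Nat
open import Data.Nat.DivMod
open import Data.Nat.Properties
open import Data.Product using (∃; _×_; _,_; proj₁; proj₂)
open import Data.Sum using (_⊎_; inj₁; inj₂; [_,_]′)
open import Function using (_∘_)
open import Relation.Binary using (Decidable; DecidableEquality)
open import Relation.Binary.PropositionalEquality
open import Relation.Nullary
open import Relation.Nullary.Decidable using (map′; _×-dec_; _⊎-dec_; _→-dec_)

open import Defs

module IntervalKernel
  (R : ℕ → ℕ → Set) (R? : Decidable R) (R⇒< : ∀ {p q} → R p q → p < q) (top : ℕ) where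

  record Kernel (lo : ℕ) : Set₁ where
    field
      S           : ℕ → Set
      S?          : ∀ p → Dec (S p)
      S⊆          : ∀ {p} → S p → lo ≤ p × p < top
      independent : ∀ {p q} → S p → S q → ¬ R p q
      absorbing   : ∀ {p} → lo ≤ p → p < top → ¬ S p → ∃ λ q → S q × R p q

  module _ {lo : ℕ} (K : Kernel (suc lo)) where
    open Kernel K

    Absorbed : Set
    Absorbed = ∃ λ q → q < top × S q × R lo q

    keep : Absorbed → Kernel lo
    keep (q , _ , Sq , lo→q) = record
      { S = S ; S? = S? ; S⊆ = S⊆′ ; independent = independent ; absorbing = absorbing′ }
      where
      S⊆′ : ∀ {p} → S p → lo ≤ p × p < top
      S⊆′ Sp = <⇒≤ (proj₁ (S⊆ Sp)) , proj₂ (S⊆ Sp)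

      absorbing′ : ∀ {p} → lo ≤ p → p < top → ¬ S p → ∃ λ q → S q × R p q
      absorbing′ lo≤p p<top ¬Sp with m≤n⇒m<n∨m≡n lo≤p
      ... | inj₁ lo<p = absorbing lo<p p<top ¬Sp
      ... | inj₂ refl = q , Sq , lo→q

    insert : lo < top → ¬ Absorbed → Kernel lo
    insert lo<top ¬absorbed = record
      { S = S′ ; S? = λ p → (p ≟ lo) ⊎-dec S? p ; S⊆ = S⊆′
      ; independent = independent′ ; absorbing = absorbing′ }
      where
      S′ : ℕ → Set
      S′ p = p ≡ lo ⊎ S p

      S⊆′ : ∀ {p} → S′ p → lo ≤ p × p < top
      S⊆′ (inj₁ refl) = ≤-refl , lo<top
      S⊆′ (inj₂ Sp)   = <⇒≤ (proj₁ (S⊆ Sp)) , proj₂ (S⊆ Sp)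

      independent′ : ∀ {p q} → S′ p → S′ q → ¬ R p q
      independent′ (inj₁ refl) (inj₁ refl) p→q = <-irrefl refl (R⇒< p→q)
      independent′ (inj₁ refl) (inj₂ Sq)   p→q = ¬absorbed (_ , proj₂ (S⊆ Sq) , Sq , p→q)
      independent′ (inj₂ Sp)   (inj₁ refl) p→q = <⇒≱ (R⇒< p→q) (<⇒≤ (proj₁ (S⊆ Sp)))
      independent′ (inj₂ Sp)   (inj₂ Sq)       = independent Sp Sq

      absorbing′ : ∀ {p} → lo ≤ p → p < top → ¬ S′ p → ∃ λ q → S′ q × R p q
      absorbing′ lo≤p p<top ¬Sp with m≤n⇒m<n∨m≡n lo≤p
      ... | inj₂ refl = ⊥-elim (¬Sp (inj₁ refl))
      ... | inj₁ lo<p with absorbing lo<p p<top (¬Sp ∘ inj₂)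
      ...   | q , Sq , p→q = q , inj₂ Sq , p→q

  kernel : ∀ {lo} → lo ≤ top → Kernel lo
  kernel {lo} lo≤top = kernelOfLength (top ∸ lo) (m∸n+n≡m lo≤top)
    where
    kernelOfLength : ∀ d {lo} → d + lo ≡ top → Kernel lo
    kernelOfLength zero refl = record
      { S = λ _ → ⊥ ; S? = λ _ → no λ () ; S⊆ = λ () ; independent = λ ()
      ; absorbing = λ lo≤p p<lo _ → contradiction lo≤p (<⇒≱ p<lo) }
    kernelOfLength (suc d) {lo} d+lo≡top
      with K ← kernelOfLength d (trans (+-suc d lo) d+lo≡top)
      with anyUpTo? (λ q → Kernel.S? K q ×-dec R? lo q) top
    ... | yes absorbed  = keep K absorbed
    ... | no ¬absorbed = insert K (subst (lo <_) d+lo≡top (s≤s (m≤n+m lo d))) ¬absorbed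

module MonochromaticSegments {C : Set} (col : ℕ → C) where

  Monochromatic : ℕ → ℕ → Set
  Monochromatic p q = ∀ {x} → p ≤ x → x < q → col x ≡ col p

  monochromatic? : DecidableEquality C → ∀ p q → Dec (Monochromatic p q)
  monochromatic? _≟C_ p q =
    map′ (λ mono {x} p≤x x<q → mono {x} x<q p≤x) (λ mono {x} x<q p≤x → mono {x} p≤x x<q)
      (allUpTo? (λ x → p ≤? x →-dec (col x ≟C col p)) q)

  monochromatic-single : ∀ p → Monochromatic p (suc p)
  monochromatic-single p p≤x x<1+p = cong col (≤-antisym (s≤s⁻¹ x<1+p) p≤x)

  monochromatic-extendˡ : ∀ {p q} → col p ≡ col (suc p) → Monochromatic (suc p) q → Monochromatic p q
  monochromatic-extendˡ p≈1+p mono p≤x x<q with m≤n⇒m<n∨m≡n p≤x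
  ... | inj₁ p<x  = trans (mono p<x x<q) (sym p≈1+p)
  ... | inj₂ refl = refl

  monochromatic-tail : ∀ {p q} → Monochromatic p q → Monochromatic (suc p) q
  monochromatic-tail {p} mono 1+p≤x x<q =
    trans (mono (≤-trans (n≤1+n p) 1+p≤x) x<q) (sym (mono (n≤1+n p) (≤-<-trans 1+p≤x x<q)))

  monochromatic-stops : ∀ {p q x} → col x ≢ col (suc x) → Monochromatic p q → p ≤ x → q ≤ suc x
  monochromatic-stops {p} {q} {x} change mono p≤x with q ≤? suc x
  ... | yes q≤1+x = q≤1+x
  ... | no  q≰1+x = contradiction (trans (mono p≤x x<q) (sym (mono (m≤n⇒m≤1+n p≤x) 1+x<q))) change
    where
    1+x<q : suc x < q
    1+x<q = ≰⇒> q≰1+x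
    x<q : x < q
    x<q = <-trans (n<1+n x) 1+x<q

module ColouredCycle (k m : ℕ) (c : Fin (suc k) → Fin m) where

  n : ℕ
  n = suc k

  G : ColoredDigraph (Fin n) (Fin m)
  G = coloredCycle n m c

  -- Position p ∈ ℕ unrolls the cycle: its arc is the one leaving vertex p mod n, whose colour is col p.
  vertexAt : ℕ → Fin n
  vertexAt p = p mod n

  toℕ-vertexAt : ∀ p → toℕ (vertexAt p) ≡ p % n
  toℕ-vertexAt p = toℕ-fromℕ< (m%n<n p n)

  vertexAt-toℕ : ∀ v → vertexAt (toℕ v) ≡ v
  vertexAt-toℕ v = toℕ-injective (trans (toℕ-vertexAt (toℕ v)) (m<n⇒m%n≡m (toℕ<n v)))

  vertexAt-periodic : ∀ p → vertexAt (p + n) ≡ vertexAt p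
  vertexAt-periodic p = toℕ-injective (begin
    toℕ (vertexAt (p + n)) ≡⟨ toℕ-vertexAt (p + n) ⟩
    (p + n) % n            ≡⟨ [m+n]%n≡m%n p n ⟩
    p % n                  ≡⟨ toℕ-vertexAt p ⟨
    toℕ (vertexAt p)       ∎)
    where open ≡-Reasoning

  cycSuc-vertexAt : ∀ p → cycSuc (vertexAt p) ≡ vertexAt (suc p)
  cycSuc-vertexAt p = toℕ-injective (begin
    toℕ (cycSuc (vertexAt p))      ≡⟨ toℕ-vertexAt (suc (toℕ (vertexAt p))) ⟩
    suc (toℕ (vertexAt p)) % n     ≡⟨ cong (λ r → suc r % n) (toℕ-vertexAt p) ⟩
    suc (p % n) % n                ≡⟨ [m+kn]%n≡m%n (suc (p % n)) (p / n) n ⟨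
    suc (p % n + p / n * n) % n    ≡⟨ cong (λ p′ → suc p′ % n) (m≡m%n+[m/n]*n p n) ⟨
    suc p % n                      ≡⟨ toℕ-vertexAt (suc p) ⟨
    toℕ (vertexAt (suc p))         ∎)
    where open ≡-Reasoning

  %-injective : ∀ {x y} → x ≤ y → y < x + n → x % n ≡ y % n → x ≡ y
  %-injective {x} {y} x≤y y<x+n x≈y with m≤n⇒m<n∨m≡n (/-monoˡ-≤ n x≤y)
  ... | inj₂ x/n≡y/n = begin
    x                  ≡⟨ m≡m%n+[m/n]*n x n ⟩
    x % n + x / n * n  ≡⟨ cong₂ (λ r d → r + d * n) x≈y x/n≡y/n ⟩
    y % n + y / n * n  ≡⟨ m≡m%n+[m/n]*n y n ⟨
    y                  ∎
    where open ≡-Reasoning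
  ... | inj₁ x/n<y/n = contradiction x+n≤y (<⇒≱ y<x+n)
    where
    open ≤-Reasoning
    x+n≤y : x + n ≤ y
    x+n≤y = begin
      x + n                      ≡⟨ cong (_+ n) (m≡m%n+[m/n]*n x n) ⟩
      x % n + x / n * n + n      ≡⟨ +-assoc (x % n) (x / n * n) n ⟩
      x % n + (x / n * n + n)    ≡⟨ cong₂ _+_ x≈y (+-comm (x / n * n) n) ⟩
      y % n + suc (x / n) * n    ≤⟨ +-monoʳ-≤ (y % n) (*-monoˡ-≤ n x/n<y/n) ⟩
      y % n + y / n * n          ≡⟨ m≡m%n+[m/n]*n y n ⟨
      y                          ∎

  vertexAt-injective-window : ∀ {lo x y} → lo ≤ x → lo ≤ y → x < lo + n → y < lo + n →
                              vertexAt x ≡ vertexAt y → x ≡ y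
  vertexAt-injective-window {lo} {x} {y} lo≤x lo≤y x<lo+n y<lo+n vx≡vy =
    [ (λ x≤y → %-injective x≤y (<-≤-trans y<lo+n (+-monoˡ-≤ n lo≤x)) x≈y)
    , (λ y≤x → sym (%-injective y≤x (<-≤-trans x<lo+n (+-monoˡ-≤ n lo≤y)) (sym x≈y)))
    ]′ (≤-total x y)
    where
    x≈y : x % n ≡ y % n
    x≈y = trans (sym (toℕ-vertexAt x)) (trans (cong toℕ vx≡vy) (toℕ-vertexAt y))

  vertexAt-surjective : ∀ lo v → ∃ λ j → j < n × vertexAt (j + lo) ≡ v
  vertexAt-surjective zero v = toℕ v , toℕ<n v , trans (cong vertexAt (+-identityʳ (toℕ v))) (vertexAt-toℕ v)
  vertexAt-surjective (suc lo) v with vertexAt-surjective lo v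
  ... | suc j , 1+j<n , refl = j , <-trans (n<1+n j) 1+j<n , cong vertexAt (+-suc j lo)
  ... | zero  , _     , refl = k , n<1+n k ,
    trans (cong vertexAt (trans (+-suc k lo) (+-comm n lo))) (vertexAt-periodic lo)

  col : ℕ → Fin m
  col p = c (vertexAt p)

  col-periodic : ∀ p → col (p + n) ≡ col p
  col-periodic p = cong c (vertexAt-periodic p)

  open MonochromaticSegments col

  hwalk-cons : ∀ {u v w} (a : CycleArc u v) (walk : Walk G v w) → IsHWalk G walk → c u ≡ c v →
               IsHWalk G (a ∷ walk)
  hwalk-cons a []         _  _   = hw-one a
  hwalk-cons a (b ∷ walk) hw u≈v = hw-cons a b walk u≈v hw

  monochromatic⇒hwalk : ∀ {p q} → p ≤ q → Monochromatic p q → HWalkTo G (vertexAt p) (vertexAt q)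
  monochromatic⇒hwalk {p} {q} p≤q = go (q ∸ p) (m∸n+n≡m p≤q)
    where
    go : ∀ d {p} → d + p ≡ q → Monochromatic p q → HWalkTo G (vertexAt p) (vertexAt q)
    go zero          refl _ = [] , hw-nil
    go (suc zero)    refl _ = cycSuc-vertexAt _ ∷ [] , hw-one _
    go (suc (suc d)) {p} refl mono with go (suc d) (+-suc (suc d) p) (monochromatic-tail mono)
    ... | walk , hw = cycSuc-vertexAt p ∷ walk ,
      hwalk-cons (cycSuc-vertexAt p) walk hw (sym (mono (n≤1+n p) (s≤s (s≤s (m≤n+m p d)))))

  hwalk⇒monochromatic : ∀ p {v} → HWalkTo G (vertexAt p) v →
                        ∃ λ q → p ≤ q × vertexAt q ≡ v × Monochromatic p q
  hwalk⇒monochromatic p (walk , hw) = go walk hw p refl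
    where
    go : ∀ {u v} (walk : Walk G u v) → IsHWalk G walk → ∀ p → u ≡ vertexAt p →
         ∃ λ q → p ≤ q × vertexAt q ≡ v × Monochromatic p q
    go [] hw-nil p u≡p = p , ≤-refl , sym u≡p , λ p≤x x<p → contradiction p≤x (<⇒≱ x<p)
    go (a ∷ []) (hw-one a) p refl =
      suc p , n≤1+n p , trans (sym (cycSuc-vertexAt p)) a , monochromatic-single p
    go (a ∷ (b ∷ walk)) (hw-cons a b walk u≈v hw) p refl
      with go (b ∷ walk) hw (suc p) (trans (sym a) (cycSuc-vertexAt p))
    ... | q , 1+p≤q , q≡v , mono = q , <⇒≤ 1+p≤q , q≡v ,
      monochromatic-extendˡ (trans u≈v (cong c (trans (sym a) (cycSuc-vertexAt p)))) mono

  ¬heteroChromatic⇒repeat : ¬ HeteroChromatic c → ∃ λ a → col a ≡ col (suc a)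
  ¬heteroChromatic⇒repeat ¬hetero with any? (λ i → c i Fin.≟ c (cycSuc i))
  ... | no ¬repeat     = contradiction (λ i i≈1+i → ¬repeat (i , i≈1+i)) ¬hetero
  ... | yes (i , i≈1+i) = toℕ i ,
    trans (subst (λ v → c v ≡ c (cycSuc v)) (sym (vertexAt-toℕ i)) i≈1+i) (cong c (cycSuc-vertexAt (toℕ i)))

  AllColoursEqual : Set
  AllColoursEqual = ∀ u v → c u ≡ c v

  ChangeIntoRun : ℕ → Set
  ChangeIntoRun a = col a ≢ col (suc a) × col (suc a) ≡ col (suc (suc a))

  changeIntoRun? : ∀ a → Dec (ChangeIntoRun a)
  changeIntoRun? a = ¬? (col a Fin.≟ col (suc a)) ×-dec (col (suc a) Fin.≟ col (suc (suc a)))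

  repeat⇒allColoursEqual⊎changeIntoRun : ∀ {a} → col a ≡ col (suc a) → AllColoursEqual ⊎ ∃ ChangeIntoRun
  repeat⇒allColoursEqual⊎changeIntoRun {a} a≈1+a with anyUpTo? (λ j → changeIntoRun? (j + a)) n
  ... | yes (j , _ , change) = inj₂ (j + a , change)
  ... | no ¬change           = inj₁ λ u v → trans (≡col-a u) (sym (≡col-a v))
    where
    repeats : ∀ d {j} → d + j ≡ n → col (j + a) ≡ col (suc (j + a))
    repeats zero refl = begin
      col (n + a)        ≡⟨ cong col (+-comm n a) ⟩
      col (a + n)        ≡⟨ col-periodic a ⟩
      col a              ≡⟨ a≈1+a ⟩
      col (suc a)        ≡⟨ col-periodic (suc a) ⟨
      col (suc a + n)    ≡⟨ cong (col ∘ suc) (+-comm a n) ⟩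
      col (suc (n + a))  ∎
      where open ≡-Reasoning
    repeats (suc d) {j} d+j≡n with col (j + a) Fin.≟ col (suc (j + a))
    ... | yes j≈1+j = j≈1+j
    ... | no  j≉1+j =
      contradiction (j , subst (j <_) d+j≡n (s≤s (m≤n+m j d)) , j≉1+j , repeats d (trans (+-suc d j) d+j≡n))
        ¬change

    constant : ∀ {j} → j ≤ n → col (j + a) ≡ col a
    constant {zero}  _     = refl
    constant {suc j} 1+j≤n = trans (sym (repeats (n ∸ j) (m∸n+n≡m (<⇒≤ 1+j≤n)))) (constant (<⇒≤ 1+j≤n))

    ≡col-a : ∀ v → c v ≡ col a
    ≡col-a v with vertexAt-surjective a v
    ... | j , j<n , refl = constant (<⇒≤ j<n)

  allColoursEqual⇒hKernel : AllColoursEqual → ∃ (IsHKernelByWalks G)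
  allColoursEqual⇒hKernel same = (_≡ vertexAt n) , independent , absorbing
    where
    independent : ∀ u v → u ≡ vertexAt n → v ≡ vertexAt n → u ≢ v → ¬ HWalkTo G u v
    independent _ _ refl refl u≢v _ = u≢v refl

    absorbing : ∀ u → u ≢ vertexAt n → ∃ λ v → v ≡ vertexAt n × HWalkTo G u v
    absorbing u _ = vertexAt n , refl ,
      subst (λ u′ → HWalkTo G u′ (vertexAt n)) (vertexAt-toℕ u)
        (monochromatic⇒hwalk (<⇒≤ (toℕ<n u)) (λ _ _ → same _ _))

  Reaches : ℕ → ℕ → Set
  Reaches p q = p < q × Monochromatic p q

  reaches? : Decidable Reaches
  reaches? p q = (p <? q) ×-dec monochromatic? Fin._≟_ p q

  module CutAt (2≤n : 2 ≤ n) (a : ℕ) (change : col a ≢ col (suc a))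
               (run : col (suc a) ≡ col (suc (suc a))) where

    b : ℕ
    b = suc a

    1+b<b+n : suc b < b + n
    1+b<b+n = s≤s (subst (_≤ a + n) (+-comm a 2) (+-monoʳ-≤ a 2≤n))

    open IntervalKernel Reaches reaches? proj₁ (b + n)
    open Kernel (kernel (<⇒≤ 1+b<b+n))

    N : Fin n → Set
    N v = ∃ λ p → S p × vertexAt p ≡ v

    monochromatic-stops-at-cut : ∀ {p q} → p < b + n → Monochromatic p q → q ≤ b + n
    monochromatic-stops-at-cut p<b+n mono = monochromatic-stops change′ mono (s≤s⁻¹ p<b+n)
      where
      change′ : col (a + n) ≢ col (suc (a + n))
      change′ a≈1+a = change (trans (sym (col-periodic a)) (trans a≈1+a (col-periodic (suc a))))

    independent′ : ∀ u v → N u → N v → u ≢ v → ¬ HWalkTo G u v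
    independent′ _ _ (p , Sp , refl) (q , Sq , refl) u≢v walk
      with hwalk⇒monochromatic p walk
    ... | q′ , p≤q′ , vq′≡vq , mono = independent Sp Sq (subst (Reaches p) q′≡q (p<q′ , mono))
      where
      p<q′ : p < q′
      p<q′ = ≤∧≢⇒< p≤q′ (λ p≡q′ → u≢v (trans (cong vertexAt p≡q′) vq′≡vq))

      q′≡q : q′ ≡ q
      q′≡q = vertexAt-injective-window (≤-trans (proj₁ (S⊆ Sp)) p≤q′) (proj₁ (S⊆ Sq))
        (s≤s (monochromatic-stops-at-cut (proj₂ (S⊆ Sp)) mono)) (m≤n⇒m≤1+n (proj₂ (S⊆ Sq))) vq′≡vq

    absorbing′ : ∀ v → ¬ N v → ∃ λ u → N u × HWalkTo G v u
    absorbing′ v ¬Nv with vertexAt-surjective b v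
    ... | suc j , 1+j<n , refl with S? (suc j + b)
    ...   | yes Sp = contradiction (_ , Sp , refl) ¬Nv
    ...   | no ¬Sp with absorbing (s≤s (m≤n+m b j)) (subst (suc j + b <_) (+-comm n b) (+-monoˡ-< b 1+j<n)) ¬Sp
    ...     | q , Sq , p<q , mono = vertexAt q , (q , Sq , refl) , monochromatic⇒hwalk (<⇒≤ p<q) mono
    absorbing′ v ¬Nv | zero , _ , refl with S? (suc b)
    ... | yes S1+b = vertexAt (suc b) , (suc b , S1+b , refl) ,
      monochromatic⇒hwalk (n≤1+n b) (monochromatic-single b)
    ... | no ¬S1+b with absorbing ≤-refl 1+b<b+n ¬S1+b
    ...   | q , Sq , 1+b<q , mono = vertexAt q , (q , Sq , refl) ,
      monochromatic⇒hwalk (<⇒≤ (<-trans (n<1+n b) 1+b<q)) (monochromatic-extendˡ run mono)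

    hKernel : ∃ (IsHKernelByWalks G)
    hKernel = N , independent′ , absorbing′

  hKernel : 2 ≤ n → ¬ HeteroChromatic c → ∃ (IsHKernelByWalks G)
  hKernel 2≤n ¬hetero with repeat⇒allColoursEqual⊎changeIntoRun (proj₂ (¬heteroChromatic⇒repeat ¬hetero))
  ... | inj₁ same               = allColoursEqual⇒hKernel same
  ... | inj₂ (a , change , run) = CutAt.hKernel 2≤n a change run

mainTheorem15 : (n m : ℕ) → 2 ≤ n → (c : Fin n → Fin m) →
    ¬ HeteroChromatic c →
    ∃ λ (N : Fin n → Set) → IsHKernelByWalks (coloredCycle n m c) N
mainTheorem15 (suc k) m 2≤n c = ColouredCycle.hKernel k m c 2≤n
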